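{- Let $\hat{\mathcal H}$ be a graph on vertex set $[n]$ that is partially shifted and triangle-free. Then $\hat{\mathcal H}$ is a complete bipartite graph with (disjoint) partite sets $X$ and $Y$, i.e. its edge set is $\{\{x,y\}:x\in X,y\in Y\}$, where $X\cup Y=[|X|+|Y|]$.
   Context: A graph $\hat{\mathcal H}$ on $[n]$ is partially shifted if for every edge $\{u,v\}\in\hat{\mathcal H}$ and every vertex $x\notin\{u,v\}$ with $x<v$: if $\{x,v\}\notin\hat{\mathcal H}$ then $\{x,u\}\in\hat{\mathcal H}$. (In the paper this is phrased as: $(i,j)\in\hat{\mathcal H}$ and $(x,j)\notin\hat{\mathcal H}$ imply $S_{xj}(\{i,j\})=\{i,x\}\in\hat{\mathcal H}$, where $S_{xj}$ replaces $j$ by $x$.) $[m]=\{1,\dots,m\}$, with $[0]=\emptyset$. -}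

module Defs where

open import Data.Nat using (ℕ; _≤_; _<_; _+_)
open import Data.Bool using (Bool; true; false)
open import Data.Product using (_×_; Σ-syntax)
open import Data.Sum using (_⊎_)
open import Data.List using (List; length)
open import Data.List.Membership.Propositional using (_∈_; _∉_)
open import Data.List.Relation.Unary.Unique.Propositional using (Unique)
open import Relation.Binary.PropositionalEquality using (_≡_; _≢_)
open import Relation.Nullary using (¬_)
open import Function.Bundles using (_⇔_)

record Graph (n : ℕ) : Set where
  field
    adj     : ℕ → ℕ → Bool
    sym     : ∀ u v → adj u v ≡ adj v u
    irrefl  : ∀ u → adj u u ≡ false
    inRange : ∀ u v → adj u v ≡ true → (1 ≤ u) × (u ≤ n)

open Graph public

PartiallyShifted : ∀ {n} → Graph n → Set
PartiallyShifted {n} H =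
  ∀ u v x → adj H u v ≡ true → 1 ≤ x → x ≤ n → x ≢ u → x ≢ v → x < v →
    adj H x v ≡ false → adj H x u ≡ true

TriangleFree : ∀ {n} → Graph n → Set
TriangleFree H =
  ∀ a b c → ¬ ((adj H a b ≡ true) × (adj H b c ≡ true) × (adj H a c ≡ true))

CompleteBipartiteInitial : ∀ {n} → Graph n → Set
CompleteBipartiteInitial {n} H =
  Σ[ X ∈ List ℕ ] Σ[ Y ∈ List ℕ ]
    Unique X × Unique Y ×
    (∀ z → z ∈ X → z ∉ Y) ×
    (length X + length Y ≤ n) ×
    (∀ z → ((z ∈ X) ⊎ (z ∈ Y)) ⇔ ((1 ≤ z) × (z ≤ length X + length Y))) ×
    (∀ u v → (adj H u v ≡ true) ⇔ (((u ∈ X) × (v ∈ Y)) ⊎ ((u ∈ Y) × (v ∈ X))))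

module Submission where

-- Shiftedness gives N(b) ⊆ N(a) whenever a < b are non-adjacent. Hence the
-- non-isolated vertices form an initial segment [1, m], and every edge has
-- exactly one endpoint in N(1): at most one as H is triangle-free, at least one
-- since an endpoint u ≠ 1 outside N(1) has N(u) ⊆ N(1). Conversely, if u ∈ N(1)
-- and v ∈ [1, m] ∖ N(1) were non-adjacent, then either v < u and
-- 1 ∈ N(u) ⊆ N(v), or u < v and any neighbour d of v lies in N(u) ∩ N(1),
-- giving a triangle. So H is complete bipartite with sides N(1), [1, m] ∖ N(1).

open import Defs
  using (Graph; adj; inRange; PartiallyShifted; TriangleFree; CompleteBipartiteInitial)
open import Data.Bool using (true; false)
open import Data.Bool.Properties using (¬-not) renaming (_≟_ to _≟ᵇ_)
open import Data.Empty using (⊥)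
open import Data.List using (List; []; _∷_; length; filter; applyUpTo)
open import Data.List.Properties using (length-applyUpTo)
open import Data.List.Membership.Propositional using (_∈_)
open import Data.List.Membership.Propositional.Properties
  using (∈-filter⁺; ∈-filter⁻; ∈-applyUpTo⁺; ∈-applyUpTo⁻)
open import Data.List.Relation.Unary.Unique.Propositional using (Unique)
open import Data.List.Relation.Unary.Unique.Propositional.Properties using (filter⁺; applyUpTo⁺₁)
open import Data.Nat using (ℕ; zero; suc; _≤_; _<_; _+_; z≤n; s≤s)
open import Data.Nat.Properties
open import Data.Product using (_×_; _,_; ∃-syntax; proj₁; proj₂; uncurry)
open import Data.Sum using (_⊎_; inj₁; inj₂)
open import Function.Bundles using (_⇔_; mk⇔)
open import Relation.Binary.Definitions using (tri<; tri≈; tri>)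
open import Relation.Binary.PropositionalEquality using (_≡_; refl; sym; trans; cong; subst)
open import Relation.Nullary using (¬_; yes; no; contradiction)
open import Relation.Unary using (Pred; Decidable)
open import Relation.Unary.Properties using (∁?)

module _ {p} {P : Pred ℕ p} (P? : Decidable P) where

  downClosed⇒initialSegment :
    (∀ {x v} → 1 ≤ x → x ≤ v → P v → P x) → ∀ k →
    ∃[ m ] m ≤ k × (∀ {v} → 1 ≤ v → v ≤ m → P v) × (∀ {v} → v ≤ k → P v → v ≤ m)
  downClosed⇒initialSegment closed zero =
    0 , z≤n , (λ 1≤v v≤0 → contradiction (≤-trans 1≤v v≤0) λ ()) , (λ v≤0 _ → v≤0)
  downClosed⇒initialSegment closed (suc k)
    with P? (suc k) | downClosed⇒initialSegment closed k
  ... | yes P[1+k] | _ =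
    suc k , ≤-refl , (λ 1≤v v≤1+k → closed 1≤v v≤1+k P[1+k]) , (λ v≤1+k _ → v≤1+k)
  ... | no ¬P[1+k] | m , m≤k , segment⇒P , P⇒segment =
    m , m≤n⇒m≤1+n m≤k , segment⇒P ,
    λ {v} v≤1+k Pv →
      P⇒segment (m<1+n⇒m≤n (≤∧≢⇒< v≤1+k λ { refl → ¬P[1+k] Pv })) Pv

module _ {a p} {A : Set a} {P : Pred A p} (P? : Decidable P) where

  length-filter+length-filter-∁ : ∀ xs →
    length (filter P? xs) + length (filter (∁? P?) xs) ≡ length xs
  length-filter+length-filter-∁ [] = refl
  length-filter+length-filter-∁ (x ∷ xs) with P? x
  ... | yes _ = cong suc (length-filter+length-filter-∁ xs)
  ... | no _ = trans (+-suc _ _) (cong suc (length-filter+length-filter-∁ xs))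

  ∈⇒∈-filter⊎∈-filter-∁ : ∀ {z xs} → z ∈ xs → z ∈ filter P? xs ⊎ z ∈ filter (∁? P?) xs
  ∈⇒∈-filter⊎∈-filter-∁ {z} z∈xs with P? z
  ... | yes Pz = inj₁ (∈-filter⁺ P? z∈xs Pz)
  ... | no ¬Pz = inj₂ (∈-filter⁺ (∁? P?) z∈xs ¬Pz)

interval : ℕ → List ℕ
interval = applyUpTo suc

∈-interval⁺ : ∀ {m v} → 1 ≤ v → v ≤ m → v ∈ interval m
∈-interval⁺ {v = suc v} (s≤s _) v≤m = ∈-applyUpTo⁺ suc v≤m

∈-interval⁻ : ∀ {m v} → v ∈ interval m → 1 ≤ v × v ≤ m
∈-interval⁻ v∈ with _ , i<m , refl ← ∈-applyUpTo⁻ suc v∈ = s≤s z≤n , i<m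

interval-unique : ∀ m → Unique (interval m)
interval-unique m = applyUpTo⁺₁ suc m (λ i<j _ → <⇒≢ (s≤s i<j))

module _ {n} (H : Graph n) where

  infix 4 _~_ _≁_
  _~_ _≁_ : ℕ → ℕ → Set
  u ~ v = adj H u v ≡ true
  u ≁ v = adj H u v ≡ false

  adj-sym : ∀ {u v b} → adj H u v ≡ b → adj H v u ≡ b
  adj-sym {u} {v} uv≡b = trans (Graph.sym H v u) uv≡b

  ~∧≁⇒⊥ : ∀ {u v} → u ~ v → u ≁ v → ⊥
  ~∧≁⇒⊥ u~v u≁v = contradiction (trans (sym u~v) u≁v) λ ()

  ~-range : ∀ {u v} → u ~ v → 1 ≤ u × u ≤ n
  ~-range {u} {v} = inRange H u v

  -- The bound on w loses nothing (edges lie in [n]) and makes the predicate decidable.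
  NonIsolated : ℕ → Set
  NonIsolated v = ∃[ w ] w < suc n × v ~ w

  nonIsolated? : Decidable NonIsolated
  nonIsolated? v = anyUpTo? (λ w → adj H v w ≟ᵇ true) (suc n)

  ~⇒nonIsolated : ∀ {u v} → u ~ v → NonIsolated u
  ~⇒nonIsolated {v = v} u~v = v , s≤s (proj₂ (~-range (adj-sym u~v))) , u~v

  module _ {s} {S : Pred ℕ s} (S? : Decidable S) {m : ℕ}
           (m≤n : m ≤ n)
           (~⇒≤m : ∀ {u v} → u ~ v → u ≤ m)
           (~⇒separated : ∀ {u v} → u ~ v → (S u × ¬ S v) ⊎ (¬ S u × S v))
           (separated⇒~ : ∀ {u v} → v ∈ interval m → S u → ¬ S v → u ~ v)
           where

    private
      X Y : List ℕ
      X = filter S? (interval m)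
      Y = filter (∁? S?) (interval m)

      ∈X⁻ : ∀ {z} → z ∈ X → z ∈ interval m × S z
      ∈X⁻ = ∈-filter⁻ S? {xs = interval m}

      ∈Y⁻ : ∀ {z} → z ∈ Y → z ∈ interval m × ¬ S z
      ∈Y⁻ = ∈-filter⁻ (∁? S?) {xs = interval m}

      |X|+|Y|≡m : length X + length Y ≡ m
      |X|+|Y|≡m = trans (length-filter+length-filter-∁ S? (interval m)) (length-applyUpTo suc m)

      ~⇒∈interval : ∀ {u v} → u ~ v → u ∈ interval m
      ~⇒∈interval u~v = ∈-interval⁺ (proj₁ (~-range u~v)) (~⇒≤m u~v)

      X∪Y≡interval : ∀ z → (z ∈ X ⊎ z ∈ Y) ⇔ (1 ≤ z × z ≤ length X + length Y)
      X∪Y≡interval z rewrite |X|+|Y|≡m = mk⇔ to from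
        where
        to : z ∈ X ⊎ z ∈ Y → 1 ≤ z × z ≤ m
        to (inj₁ z∈X) = ∈-interval⁻ (proj₁ (∈X⁻ z∈X))
        to (inj₂ z∈Y) = ∈-interval⁻ (proj₁ (∈Y⁻ z∈Y))
        from : 1 ≤ z × z ≤ m → z ∈ X ⊎ z ∈ Y
        from (1≤z , z≤m) = ∈⇒∈-filter⊎∈-filter-∁ S? (∈-interval⁺ 1≤z z≤m)

      edges≡X×Y : ∀ u v → (u ~ v) ⇔ ((u ∈ X × v ∈ Y) ⊎ (u ∈ Y × v ∈ X))
      edges≡X×Y u v = mk⇔ to from
        where
        to : u ~ v → (u ∈ X × v ∈ Y) ⊎ (u ∈ Y × v ∈ X)
        to u~v with ~⇒separated u~v
        ... | inj₁ (Su , ¬Sv) =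
          inj₁ (∈-filter⁺ S? u∈I Su , ∈-filter⁺ (∁? S?) v∈I ¬Sv)
          where u∈I = ~⇒∈interval u~v; v∈I = ~⇒∈interval (adj-sym u~v)
        ... | inj₂ (¬Su , Sv) =
          inj₂ (∈-filter⁺ (∁? S?) u∈I ¬Su , ∈-filter⁺ S? v∈I Sv)
          where u∈I = ~⇒∈interval u~v; v∈I = ~⇒∈interval (adj-sym u~v)
        from : (u ∈ X × v ∈ Y) ⊎ (u ∈ Y × v ∈ X) → u ~ v
        from (inj₁ (u∈X , v∈Y)) with v∈I , ¬Sv ← ∈Y⁻ v∈Y =
          separated⇒~ v∈I (proj₂ (∈X⁻ u∈X)) ¬Sv
        from (inj₂ (u∈Y , v∈X)) with u∈I , ¬Su ← ∈Y⁻ u∈Y =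
          adj-sym (separated⇒~ u∈I (proj₂ (∈X⁻ v∈X)) ¬Su)

    completeBipartiteInitial-bySide : CompleteBipartiteInitial H
    completeBipartiteInitial-bySide =
      X , Y , filter⁺ S? (interval-unique m) , filter⁺ (∁? S?) (interval-unique m) ,
      (λ z z∈X z∈Y → proj₂ (∈Y⁻ z∈Y) (proj₂ (∈X⁻ z∈X))) ,
      subst (_≤ n) (sym |X|+|Y|≡m) m≤n , X∪Y≡interval , edges≡X×Y

  module _ (shifted : PartiallyShifted H) where

    ≁⇒neighbours-⊆ : ∀ {a b c} → 1 ≤ a → a < b → a ≁ b → b ~ c → a ~ c
    ≁⇒neighbours-⊆ {a} {b} {c} 1≤a a<b a≁b b~c =
      shifted c b a (adj-sym b~c) 1≤a (≤-trans (<⇒≤ a<b) (proj₂ (~-range b~c)))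
        (λ { refl → ~∧≁⇒⊥ (adj-sym b~c) a≁b }) (<⇒≢ a<b) a<b a≁b

    nonIsolated-downClosed : ∀ {x v} → 1 ≤ x → x ≤ v → NonIsolated v → NonIsolated x
    nonIsolated-downClosed {x} {v} 1≤x x≤v v-nonIsolated@(w , _ , v~w)
      with m≤n⇒m<n∨m≡n x≤v
    ... | inj₂ refl = v-nonIsolated
    ... | inj₁ x<v with adj H x v in adj-xv
    ...   | true = ~⇒nonIsolated adj-xv
    ...   | false = ~⇒nonIsolated (≁⇒neighbours-⊆ 1≤x x<v adj-xv v~w)

    module _ (triangleFree : TriangleFree H) where

      ~⇒separatedBy1 : ∀ {u v} → u ~ v → (1 ~ u × ¬ 1 ~ v) ⊎ (¬ 1 ~ u × 1 ~ v)
      ~⇒separatedBy1 {u} {v} u~v with adj H 1 u in adj-1u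
      ... | true = inj₁ (refl , λ 1~v → triangleFree 1 u v (adj-1u , u~v , 1~v))
      ... | false with m≤n⇒m<n∨m≡n (proj₁ (~-range u~v))
      ...   | inj₁ 1<u = inj₂ ((λ ()) , ≁⇒neighbours-⊆ ≤-refl 1<u adj-1u u~v)
      ...   | inj₂ refl = inj₂ ((λ ()) , u~v)

      separatedBy1⇒~ : ∀ {u v} → NonIsolated v → 1 ~ u → ¬ 1 ~ v → u ~ v
      separatedBy1⇒~ {u} {v} (d , _ , v~d) 1~u ¬1~v = ¬-not ¬u≁v
        where
        1≁v : 1 ≁ v
        1≁v = ¬-not ¬1~v

        ¬u≁v : ¬ u ≁ v
        ¬u≁v u≁v with <-cmp u v
        ... | tri≈ _ refl _ = ~∧≁⇒⊥ 1~u 1≁v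
        ... | tri< u<v _ _ = triangleFree 1 u d (1~u , u~d , 1~d)
          where
          1≤u = proj₁ (~-range (adj-sym 1~u))
          u~d = ≁⇒neighbours-⊆ 1≤u u<v u≁v v~d
          1~d = ≁⇒neighbours-⊆ ≤-refl (≤-<-trans 1≤u u<v) 1≁v v~d
        ... | tri> _ _ v<u = ~∧≁⇒⊥ v~1 (adj-sym 1≁v)
          where
          v~1 = ≁⇒neighbours-⊆ (proj₁ (~-range v~d)) v<u (adj-sym u≁v) (adj-sym 1~u)

lemma2p5 : (n : ℕ) (H : Graph n) → PartiallyShifted H → TriangleFree H →
    CompleteBipartiteInitial H
lemma2p5 n H shifted triangleFree
  with m , m≤n , ≤m⇒nonIsolated , nonIsolated⇒≤m ←
         downClosed⇒initialSegment (nonIsolated? H) (nonIsolated-downClosed H shifted) n =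
  completeBipartiteInitial-bySide H (λ u → adj H 1 u ≟ᵇ true) m≤n
    (λ u~v → nonIsolated⇒≤m (proj₂ (~-range H u~v)) (~⇒nonIsolated H u~v))
    (~⇒separatedBy1 H shifted triangleFree)
    (λ v∈[1,m] → separatedBy1⇒~ H shifted triangleFree
       (uncurry ≤m⇒nonIsolated (∈-interval⁻ v∈[1,m])))
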